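{- For each finite $\mathsf{X}$ and each convex union-closed property $\mathcal{P}=\{t_1,\dots,t_n\}$ over $\mathsf{X}$: (a) if $\mathcal{P}=\emptyset$, then $\mathcal{P}=\|\bot\wedge\mathrm{NE}\|_{\mathsf{X}}$; (b) if $\emptyset\in\mathcal{P}$, then $\mathcal{P}=\|\bigvee_{s\in\mathcal{P}}\chi^{\mathsf{X}}_s\|_{\mathsf{X}}$; (c) if $\mathcal{P}\neq\emptyset$ and $\emptyset\notin\mathcal{P}$, then $$\mathcal{P}=\Big\|\bigvee_{v_1\in t_1,\dots,v_n\in t_n}\big((\chi^{\mathsf{X}}_{v_1}\vee\cdots\vee\chi^{\mathsf{X}}_{v_n})\wedge\mathrm{NE}\big)\Big\|_{\mathsf{X}}.$$
   Context: Propositional team semantics, teams $t\subseteq 2^{\mathsf{X}}$; $\|\phi\|_{\mathsf{X}}:=\{t\subseteq 2^{\mathsf{X}}:t\vDash\phi\}$. $\vee$ is the split disjunction: $t\vDash\phi\vee\psi$ iff $t=s\cup u$ with $s\vDash\phi,u\vDash\psi$ (empty split disjunction is $\bot$); $t\vDash\bot$ iff $t=\emptyset$; $t\vDash\mathrm{NE}$ iff $t\neq\emptyset$. For a valuation $v$, $\chi^{\mathsf{X}}_v:=\bigwedge\{p:p\in\mathsf{X},v(p)=1\}\wedge\bigwedge\{\neg p:p\in\mathsf{X},v(p)=0\}$; for a team $s$, $\chi^{\mathsf{X}}_s:=\neg\bigwedge_{v\in s}\neg\chi^{\mathsf{X}}_v$ (classical disjunction of the $\chi^{\mathsf{X}}_v$),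 so $u\vDash\chi^{\mathsf{X}}_s$ iff $u\subseteq s$. A property is convex if $s,t\in\mathcal{P}$, $s\subseteq u\subseteq t$ imply $u\in\mathcal{P}$; union closed if the union of any nonempty subcollection of $\mathcal{P}$ is in $\mathcal{P}$. -}

module Defs where

open import Data.Nat using (ℕ; zero; suc)
open import Data.Fin using (Fin)
open import Data.Bool using (Bool; true; false; not; _∨_) renaming (_∧_ to _&&_)
open import Data.Vec using (Vec; []; _∷_; lookup)
open import Data.List using (List; []; _∷_; map; concatMap)
open import Data.List.Relation.Unary.Any using (Any)
open import Data.Product using (Σ; ∃; ∃₂; _×_; _,_)
open import Relation.Binary.PropositionalEquality using (_≡_)
open import Function.Bundles using (_⇔_)

-- The finite set of propositional variables X is Fin k.
-- A valuation v : X → 2 is a vector of booleans.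
Val : ℕ → Set
Val k = Vec Bool k

-- A team t ⊆ 2^X, given by its (decidable) membership function.
Team : ℕ → Set
Team k = Val k → Bool

emptyTeam : ∀ {k} → Team k
emptyTeam _ = false

_⊆ᵗ_ : ∀ {k} → Team k → Team k → Set
s ⊆ᵗ u = ∀ v → s v ≡ true → u v ≡ true

allVals : (k : ℕ) → List (Val k)
allVals zero = [] ∷ []
allVals (suc k) = concatMap (λ v → (true ∷ v) ∷ (false ∷ v) ∷ []) (allVals k)

filterB : ∀ {A : Set} → (A → Bool) → List A → List A
filterB p [] = []
filterB p (x ∷ xs) with p x
... | true = x ∷ filterB p xs
... | false = filterB p xs

members : ∀ {k} → Team k → List (Val k)
members {k} t = filterB t (allVals k)

data CFm (k : ℕ) : Set where
  atom : Fin k → CFm k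
  ctop : CFm k
  neg  : CFm k → CFm k
  cand : CFm k → CFm k → CFm k

data Fm (k : ℕ) : Set where
  cl   : CFm k → Fm k
  bot  : Fm k
  NE   : Fm k
  _∧ᶠ_ : Fm k → Fm k → Fm k
  _∨ᶠ_ : Fm k → Fm k → Fm k

evalC : ∀ {k} → Val k → CFm k → Bool
evalC v (atom i) = lookup v i
evalC v ctop = true
evalC v (neg α) = not (evalC v α)
evalC v (cand α β) = evalC v α && evalC v β

_⊨_ : ∀ {k} → Team k → Fm k → Set
t ⊨ cl α = ∀ v → t v ≡ true → evalC v α ≡ true
t ⊨ bot = ∀ v → t v ≡ false
t ⊨ NE = ∃ λ v → t v ≡ true
t ⊨ (φ ∧ᶠ ψ) = (t ⊨ φ) × (t ⊨ ψ)
t ⊨ (φ ∨ᶠ ψ) = ∃₂ λ s u → (∀ v → t v ≡ (s v ∨ u v)) × (s ⊨ φ) × (u ⊨ ψ)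

⋀ : ∀ {k} → List (CFm k) → CFm k
⋀ [] = ctop
⋀ (α ∷ []) = α
⋀ (α ∷ β ∷ αs) = cand α (⋀ (β ∷ αs))

⋁ : ∀ {k} → List (Fm k) → Fm k
⋁ [] = bot
⋁ (φ ∷ []) = φ
⋁ (φ ∷ ψ ∷ φs) = φ ∨ᶠ ⋁ (ψ ∷ φs)

allFinL : (k : ℕ) → List (Fin k)
allFinL zero = []
allFinL (suc k) = Fin.zero ∷ map Fin.suc (allFinL k)
  where import Data.Fin as Fin

χv : ∀ {k} → Val k → CFm k
χv {k} v = ⋀ (map lit (allFinL k))
  where
  lit : Fin k → CFm k
  lit i with lookup v i
  ... | true = atom i
  ... | false = neg (atom i)

χs : ∀ {k} → Team k → CFm k
χs s = neg (⋀ (map (λ v → neg (χv v)) (members s)))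

-- Properties P = {t₁,…,tₙ}, given by an enumerating list.

_∈P_ : ∀ {k} → Team k → List (Team k) → Set
u ∈P P = Any (λ t → ∀ v → u v ≡ t v) P

_≐‖_‖ : ∀ {k} → List (Team k) → Fm k → Set
P ≐‖ φ ‖ = ∀ u → (u ∈P P) ⇔ (u ⊨ φ)

Convex : ∀ {k} → List (Team k) → Set
Convex {k} P = ∀ (s t u : Team k) → s ∈P P → t ∈P P → s ⊆ᵗ u → u ⊆ᵗ t → u ∈P P

UnionClosed : ∀ {k} → List (Team k) → Set₁
UnionClosed {k} P =
  ∀ (Q : Team k → Set) → (∀ t → Q t → t ∈P P) → (∃ λ t → Q t) →
  ∀ (u : Team k) → (∀ v → (u v ≡ true) ⇔ (∃ λ t → Q t × t v ≡ true)) → u ∈P P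

choices : ∀ {k} → List (Team k) → List (List (Val k))
choices [] = [] ∷ []
choices (t ∷ ts) = concatMap (λ v → map (v ∷_) (choices ts)) (members t)

formB : ∀ {k} → List (Team k) → Fm k
formB P = ⋁ (map (λ s → cl (χs s)) P)

formC : ∀ {k} → List (Team k) → Fm k
formC P = ⋁ (map (λ vs → ⋁ (map (λ v → cl (χv v)) vs) ∧ᶠ NE) (choices P))

-- (b) With ∅ ∈ P, convexity and union closure make P the set of all subteams of ⋃P, and
-- since the split disjunction of classical formulas is their classical disjunction, the
-- formula ⋁_{s ∈ P} χ_s defines exactly the teams covered by members of P.
-- (c) A member t satisfies the formula as the union, over all choice tuples c, of the
-- slices t ∩ c; each slice is nonempty because c picks a point of t. Conversely, if u
-- satisfies it, some member t lies below u: otherwise a choice of points outside u, one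
-- per member, would index a disjunct contributing a point of u outside u. Every point of
-- u is picked from some member meeting u, so u lies between t and the union of the
-- members meeting u, which is in P; convexity gives u ∈ P.
module Submission where

open import Defs
open import Data.Nat using (ℕ)
open import Data.Bool using (Bool; true; false; not; _∨_) renaming (_∧_ to _&&_)
import Data.Bool as Bool
open import Data.Bool.Properties using (∨-identityʳ; not-involutive; ¬-not)
open import Data.Fin using (Fin; zero; suc)
open import Data.Vec using (Vec; []; _∷_; lookup; tabulate)
open import Data.Vec.Properties using (≡-dec; tabulate∘lookup; tabulate-cong)
open import Data.List using (List; []; _∷_; map; filter)
open import Data.Bool.ListAction using (any)
open import Data.List.Relation.Unary.Any as Any using (Any; here; there; any?)
open import Data.List.Relation.Unary.All as All using (All; []; _∷_)
open import Data.List.Relation.Unary.All.Properties using (map⁺; map⁻; ¬All⇒Any¬)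
open import Data.List.Relation.Binary.Pointwise using (Pointwise; []; _∷_)
open import Data.List.Relation.Binary.Subset.Propositional using (_⊆_)
open import Data.List.Membership.Propositional using (_∈_; find; lose)
open import Data.List.Membership.Propositional.Properties
  using (∈-map⁺; ∈-map⁻; ∈-concatMap⁺; ∈-concatMap⁻; ∈-filter⁺; ∈-filter⁻)
import Data.List.Membership.DecPropositional as DecMembership
open import Data.Product using (∃; _×_; _,_; proj₁; proj₂)
open import Data.Sum using (_⊎_; inj₁; inj₂; [_,_]′)
open import Data.Unit using (⊤; tt)
open import Function using (_∘_; id)
open import Function.Bundles using (_⇔_; mk⇔; Equivalence)
open import Function.Construct.Composition using (_⇔-∘_)
open import Function.Construct.Symmetry using (⇔-sym)
open import Relation.Nullary using (¬_; Dec; yes; no; does; contradiction; _×-dec_)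
open import Relation.Unary using (Decidable)
open import Relation.Binary.Definitions using (DecidableEquality)
open import Relation.Binary.PropositionalEquality

open Equivalence using (to; from)

private
  variable
    A B : Set
    k : ℕ

≡-true⇔⇒≡ : ∀ {x y} → (x ≡ true ⇔ y ≡ true) → x ≡ y
≡-true⇔⇒≡ {true}  x⇔y = sym (to x⇔y refl)
≡-true⇔⇒≡ {false} {false} x⇔y = refl
≡-true⇔⇒≡ {false} {true}  x⇔y = from x⇔y refl

not-≡-true⇔ : ∀ {x} → not x ≡ true ⇔ (¬ x ≡ true)
not-≡-true⇔ {true}  = mk⇔ (λ ()) (λ x≢true → contradiction refl x≢true)
not-≡-true⇔ {false} = mk⇔ (λ _ ()) (λ _ → refl)

&&-≡-true⇔ : ∀ {x y} → x && y ≡ true ⇔ (x ≡ true × y ≡ true)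
&&-≡-true⇔ {true}  = mk⇔ (refl ,_) proj₂
&&-≡-true⇔ {false} = mk⇔ (λ ()) (λ ())

∨-≡-true⇔ : ∀ {x y} → x ∨ y ≡ true ⇔ (x ≡ true ⊎ y ≡ true)
∨-≡-true⇔ {true}  = mk⇔ inj₁ (λ _ → refl)
∨-≡-true⇔ {false} = mk⇔ inj₂ (λ { (inj₁ ()) ; (inj₂ y≡true) → y≡true })

does-≡-true⇔ : ∀ {P : Set} (P? : Dec P) → does P? ≡ true ⇔ P
does-≡-true⇔ (yes p) = mk⇔ (λ _ → p) (λ _ → refl)
does-≡-true⇔ (no ¬p) = mk⇔ (λ ()) (λ p → contradiction p ¬p)

any-≡-true⇔ : (p : A → Bool) (xs : List A) → any p xs ≡ true ⇔ Any (λ x → p x ≡ true) xs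
any-≡-true⇔ p []       = mk⇔ (λ ()) (λ ())
any-≡-true⇔ p (x ∷ xs) = mk⇔
  (λ e → [ here , there ∘ to (any-≡-true⇔ p xs) ]′ (to ∨-≡-true⇔ e))
  (λ { (here px)   → from ∨-≡-true⇔ (inj₁ px)
     ; (there pxs) → from ∨-≡-true⇔ (inj₂ (from (any-≡-true⇔ p xs) pxs)) })

any-or-all : {P Q : A → Set} → (∀ x → P x ⊎ Q x) → (xs : List A) → Any P xs ⊎ All Q xs
any-or-all P⊎Q [] = inj₂ []
any-or-all P⊎Q (x ∷ xs) with P⊎Q x | any-or-all P⊎Q xs
... | inj₁ px | _        = inj₁ (here px)
... | inj₂ _  | inj₁ pxs = inj₁ (there pxs)
... | inj₂ qx | inj₂ qxs = inj₂ (qx ∷ qxs)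

∈-filterB⇔ : ∀ (p : A → Bool) {x} xs → x ∈ filterB p xs ⇔ (x ∈ xs × p x ≡ true)
∈-filterB⇔ p {x} xs = mk⇔ (⇒ xs) (λ (x∈xs , px) → ⇐ xs x∈xs px)
  where
  ⇒ : ∀ xs → x ∈ filterB p xs → x ∈ xs × p x ≡ true
  ⇒ (y ∷ ys) x∈ with p y in py
  ⇒ (y ∷ ys) (here refl) | true = here refl , py
  ⇒ (y ∷ ys) (there x∈)  | true = let (x∈ys , px) = ⇒ ys x∈ in there x∈ys , px
  ⇒ (y ∷ ys) x∈          | false = let (x∈ys , px) = ⇒ ys x∈ in there x∈ys , px
  ⇐ : ∀ xs → x ∈ xs → p x ≡ true → x ∈ filterB p xs
  ⇐ (y ∷ ys) x∈ px with p y in py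
  ⇐ (y ∷ ys) (here refl) px | true  = here refl
  ⇐ (y ∷ ys) (there x∈)  px | true  = there (⇐ ys x∈ px)
  ⇐ (y ∷ ys) (here refl) px | false = contradiction (trans (sym px) py) λ ()
  ⇐ (y ∷ ys) (there x∈)  px | false = ⇐ ys x∈ px

∈-allVals : (v : Val k) → v ∈ allVals k
∈-allVals []          = here refl
∈-allVals (true ∷ v)  = ∈-concatMap⁺ _ (lose (∈-allVals v) (here refl))
∈-allVals (false ∷ v) = ∈-concatMap⁺ _ (lose (∈-allVals v) (there (here refl)))

∈-members⇔ : ∀ (t : Team k) {v} → v ∈ members t ⇔ t v ≡ true
∈-members⇔ {k} t {v} = mk⇔
  (proj₂ ∘ to (∈-filterB⇔ t (allVals k)))
  (λ tv → from (∈-filterB⇔ t (allVals k)) (∈-allVals v , tv))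

∃-Val? : {Q : Val k → Set} → Decidable Q → Dec (∃ Q)
∃-Val? {k} Q? with any? Q? (allVals k)
... | yes q = yes (let (v , _ , qv) = find q in v , qv)
... | no ¬q = no (λ (v , qv) → ¬q (lose (∈-allVals v) qv))

_≟ᵛ_ : DecidableEquality (Val k)
_≟ᵛ_ = ≡-dec Bool._≟_

_∈ᵛ?_ : (v : Val k) (vs : List (Val k)) → Dec (v ∈ vs)
v ∈ᵛ? vs = DecMembership._∈?_ _≟ᵛ_ v vs

module _ {R : A → B → Set} where

  Pointwise-∈ˡ : ∀ {xs ys x} → Pointwise R xs ys → x ∈ xs → ∃ λ y → y ∈ ys × R x y
  Pointwise-∈ˡ (r ∷ _)  (here refl) = _ , here refl , r
  Pointwise-∈ˡ (_ ∷ rs) (there x∈)  = let (y , y∈ , r) = Pointwise-∈ˡ rs x∈ in y , there y∈ , r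

  Pointwise-∈ʳ : ∀ {xs ys y} → Pointwise R xs ys → y ∈ ys → ∃ λ x → x ∈ xs × R x y
  Pointwise-∈ʳ (r ∷ _)  (here refl) = _ , here refl , r
  Pointwise-∈ʳ (_ ∷ rs) (there y∈)  = let (x , x∈ , r) = Pointwise-∈ʳ rs y∈ in x , there x∈ , r

  Pointwise-choose : ∀ {Q : A → Set} {ys} → All (λ y → ∃ λ x → R x y × Q x) ys →
    ∃ λ xs → Pointwise R xs ys × All Q xs
  Pointwise-choose [] = [] , [] , []
  Pointwise-choose ((x , r , q) ∷ rqs) =
    let (xs , rs , qs) = Pointwise-choose rqs in x ∷ xs , r ∷ rs , q ∷ qs

  Pointwise-choose-through : ∀ {ys x y} → All (λ y → ∃ λ x → R x y) ys → y ∈ ys → R x y →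
    ∃ λ xs → Pointwise R xs ys × x ∈ xs
  Pointwise-choose-through (_ ∷ rs) (here refl) r =
    let (xs , rxs , _) = Pointwise-choose {Q = λ _ → ⊤} (All.map (λ (x , r) → x , r , tt) rs)
    in _ , r ∷ rxs , here refl
  Pointwise-choose-through ((x′ , r′) ∷ rs) (there y∈) r =
    let (xs , rxs , x∈) = Pointwise-choose-through rs y∈ r in x′ ∷ xs , r′ ∷ rxs , there x∈

Choice : List (Val k) → List (Team k) → Set
Choice = Pointwise (λ v t → t v ≡ true)

∈-choices⇔ : ∀ {c} (P : List (Team k)) → c ∈ choices P ⇔ Choice c P
∈-choices⇔ P = mk⇔ (⇒ P) (⇐ P)
  where
  ⇒ : ∀ {c} P → c ∈ choices P → Choice c P
  ⇒ []       (here refl) = []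
  ⇒ (t ∷ ts) c∈ with find (∈-concatMap⁻ _ {xs = members t} c∈)
  ... | v , v∈t , c∈′ with ∈-map⁻ (v ∷_) c∈′
  ... | c′ , c′∈ , refl = to (∈-members⇔ t) v∈t ∷ ⇒ ts c′∈
  ⇐ : ∀ {c} P → Choice c P → c ∈ choices P
  ⇐ [] [] = here refl
  ⇐ (t ∷ ts) (tv ∷ ch) = ∈-concatMap⁺ _ (lose (from (∈-members⇔ t) tv) (∈-map⁺ _ (⇐ ts ch)))

⋃ᵗ : List A → (A → Team k) → Team k
⋃ᵗ as g w = any (λ a → g a w) as

∈-⋃ᵗ⇔ : ∀ (as : List A) (g : A → Team k) {w} → ⋃ᵗ as g w ≡ true ⇔ (∃ λ a → a ∈ as × g a w ≡ true)
∈-⋃ᵗ⇔ as g = mk⇔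
  (find ∘ to (any-≡-true⇔ _ as))
  (λ (a , a∈ , gaw) → from (any-≡-true⇔ _ as) (lose a∈ gaw))

∈⇒∈P : ∀ {t : Team k} {P} → t ∈ P → t ∈P P
∈⇒∈P t∈P = lose t∈P (λ _ → refl)

⊨-resp-≗ : ∀ (φ : Fm k) {t t′} → t ≗ t′ → t ⊨ φ → t′ ⊨ φ
⊨-resp-≗ (cl α)    t≗t′ t⊨ w t′w = t⊨ w (trans (t≗t′ w) t′w)
⊨-resp-≗ bot       t≗t′ t⊨ w = trans (sym (t≗t′ w)) (t⊨ w)
⊨-resp-≗ NE        t≗t′ (w , tw) = w , trans (sym (t≗t′ w)) tw
⊨-resp-≗ (φ ∧ᶠ ψ) t≗t′ (t⊨φ , t⊨ψ) = ⊨-resp-≗ φ t≗t′ t⊨φ , ⊨-resp-≗ ψ t≗t′ t⊨ψ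
⊨-resp-≗ (φ ∨ᶠ ψ) t≗t′ (s , u , t≗s∪u , s⊨φ , u⊨ψ) =
  s , u , (λ w → trans (sym (t≗t′ w)) (t≗s∪u w)) , s⊨φ , u⊨ψ

module _ (F : A → Fm k) where

  ⋁-intro : ∀ (as : List A) (g : A → Team k) → (∀ {a} → a ∈ as → g a ⊨ F a) → ⋃ᵗ as g ⊨ ⋁ (map F as)
  ⋁-intro []           g ⊨F w = refl
  ⋁-intro (a ∷ [])     g ⊨F = ⊨-resp-≗ (F a) (λ w → sym (∨-identityʳ (g a w))) (⊨F (here refl))
  ⋁-intro (a ∷ b ∷ as) g ⊨F =
    g a , ⋃ᵗ (b ∷ as) g , (λ w → refl) , ⊨F (here refl) , ⋁-intro (b ∷ as) g (⊨F ∘ there)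

  ⋁-part : ∀ {as u a} → u ⊨ ⋁ (map F as) → a ∈ as → ∃ λ s → s ⊨ F a × s ⊆ᵗ u
  ⋁-part {a ∷ []}     u⊨ (here refl) = _ , u⊨ , λ w uw → uw
  ⋁-part {a ∷ b ∷ as} (s , s′ , u≗s∪s′ , s⊨ , _) (here refl) =
    s , s⊨ , λ w sw → trans (u≗s∪s′ w) (from ∨-≡-true⇔ (inj₁ sw))
  ⋁-part {a ∷ b ∷ as} (s , s′ , u≗s∪s′ , _ , s′⊨) (there a∈) =
    let (r , r⊨ , r⊆s′) = ⋁-part s′⊨ a∈
    in r , r⊨ , λ w rw → trans (u≗s∪s′ w) (from ∨-≡-true⇔ (inj₂ (r⊆s′ w rw)))

  ⋁-cover : ∀ {as u w} → u ⊨ ⋁ (map F as) → u w ≡ true →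
    ∃ λ a → a ∈ as × ∃ λ s → s ⊨ F a × s w ≡ true
  ⋁-cover {[]}         {w = w} u⊨ uw = contradiction (trans (sym uw) (u⊨ w)) λ ()
  ⋁-cover {a ∷ []}     u⊨ uw = a , here refl , _ , u⊨ , uw
  ⋁-cover {a ∷ b ∷ as} {w = w} (s , s′ , u≗s∪s′ , s⊨ , s′⊨) uw =
    [ (λ sw → a , here refl , s , s⊨ , sw)
    , (λ s′w → let (a′ , a′∈ , rest) = ⋁-cover s′⊨ s′w in a′ , there a′∈ , rest)
    ]′ (to ∨-≡-true⇔ (trans (sym (u≗s∪s′ w)) uw))

⋁-cl⇔ : ∀ (f : A → CFm k) as {u} →
  u ⊨ ⋁ (map (cl ∘ f) as) ⇔ (∀ w → u w ≡ true → Any (λ a → evalC w (f a) ≡ true) as)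
⋁-cl⇔ {A = A} {k = k} f as {u} = mk⇔ covered-by-disjuncts disjunction-of-pieces
  where
  Covered : Set
  Covered = ∀ w → u w ≡ true → Any (λ a → evalC w (f a) ≡ true) as
  covered-by-disjuncts : u ⊨ ⋁ (map (cl ∘ f) as) → Covered
  covered-by-disjuncts u⊨ w uw = let (a , a∈ , s , s⊨ , sw) = ⋁-cover (cl ∘ f) u⊨ uw in lose a∈ (s⊨ w sw)
  disjunction-of-pieces : Covered → u ⊨ ⋁ (map (cl ∘ f) as)
  disjunction-of-pieces covered =
    ⊨-resp-≗ (⋁ (map (cl ∘ f) as)) ⋃piece≗u (⋁-intro (cl ∘ f) as piece (λ _ w → proj₂ ∘ to &&-≡-true⇔))
    where
    piece : A → Team k
    piece a w = u w && evalC w (f a)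
    ⋃piece≗u : ⋃ᵗ as piece ≗ u
    ⋃piece≗u w = ≡-true⇔⇒≡ (mk⇔
      (λ e → let (_ , _ , piece-w) = to (∈-⋃ᵗ⇔ as piece) e in proj₁ (to &&-≡-true⇔ piece-w))
      (λ uw → let (a , a∈ , faw) = find (covered w uw)
              in from (∈-⋃ᵗ⇔ as piece) (a , a∈ , from &&-≡-true⇔ (uw , faw))))

⋀-≡-true⇔ : ∀ (w : Val k) αs → evalC w (⋀ αs) ≡ true ⇔ All (λ α → evalC w α ≡ true) αs
⋀-≡-true⇔ w []           = mk⇔ (λ _ → []) (λ _ → refl)
⋀-≡-true⇔ w (α ∷ [])     = mk⇔ (_∷ []) All.head
⋀-≡-true⇔ w (α ∷ β ∷ αs) = mk⇔
  (λ e → let (wα , wβαs) = to &&-≡-true⇔ e in wα ∷ to (⋀-≡-true⇔ w (β ∷ αs)) wβαs)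
  (λ wαβαs → from &&-≡-true⇔ (All.head wαβαs , from (⋀-≡-true⇔ w (β ∷ αs)) (All.tail wαβαs)))

∈-allFinL : (i : Fin k) → i ∈ allFinL k
∈-allFinL zero    = here refl
∈-allFinL (suc i) = there (∈-map⁺ suc (∈-allFinL i))

lookup-injective : ∀ {n} (w v : Vec A n) → lookup w ≗ lookup v → w ≡ v
lookup-injective w v w≗v = begin
  w                   ≡⟨ tabulate∘lookup w ⟨
  tabulate (lookup w) ≡⟨ tabulate-cong w≗v ⟩
  tabulate (lookup v) ≡⟨ tabulate∘lookup v ⟩
  v                   ∎
  where open ≡-Reasoning

χv-≡-true⇔ : ∀ (v w : Val k) → evalC w (χv v) ≡ true ⇔ w ≡ v
χv-≡-true⇔ {k} v w = mk⇔ (λ e → lookup-injective w v (agrees e)) (λ { refl → self })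
  where
  agrees : evalC w (χv v) ≡ true → ∀ i → lookup w i ≡ lookup v i
  agrees e i with All.lookup (map⁻ (to (⋀-≡-true⇔ w _) e)) (∈-allFinL i)
  ... | lit-true with lookup v i
  ...   | true  = lit-true
  ...   | false with lookup w i
  ...     | true  = contradiction lit-true λ ()
  ...     | false = refl
  -- The literals of χv live in its where block and cannot be named here, so their clauses
  -- are reached only through a hypothesis mentioning them: hence the detour via a false one.
  self : evalC v (χv v) ≡ true
  self with evalC v (χv v) Bool.≟ true
  ... | yes χv-true = χv-true
  ... | no ¬χv-true
    with find (¬All⇒Any¬ (λ _ → _ Bool.≟ true) (allFinL k) (¬χv-true ∘ from (⋀-≡-true⇔ v _) ∘ map⁺))
  ...   | i , _ , lit-false with lookup v i in vi
  ...     | true  = contradiction vi lit-false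
  ...     | false = contradiction (cong not vi) lit-false

evalC-χs : ∀ (s : Team k) w → evalC w (χs s) ≡ s w
evalC-χs s w = begin
  not outside         ≡⟨ cong not (≡-true⇔⇒≡ (mk⇔ outside⇒ ⇒outside)) ⟩
  not (not (s w))     ≡⟨ not-involutive (s w) ⟩
  s w                 ∎
  where
  open ≡-Reasoning
  outside : Bool
  outside = evalC w (⋀ (map (λ v → neg (χv v)) (members s)))
  outside⇒ : outside ≡ true → not (s w) ≡ true
  outside⇒ e = from not-≡-true⇔ λ sw →
    to not-≡-true⇔ (All.lookup (map⁻ (to (⋀-≡-true⇔ w _) e)) (from (∈-members⇔ s) sw))
      (from (χv-≡-true⇔ w w) refl)
  ⇒outside : not (s w) ≡ true → outside ≡ true
  ⇒outside ¬sw = from (⋀-≡-true⇔ w _) (map⁺ (All.tabulate λ {v} v∈s → from not-≡-true⇔ λ wχv →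
    to not-≡-true⇔ ¬sw
      (to (∈-members⇔ s) (subst (_∈ members s) (sym (to (χv-≡-true⇔ v w) wχv)) v∈s))))

⋁χv⇔ : ∀ (c : List (Val k)) {u} → u ⊨ ⋁ (map (cl ∘ χv) c) ⇔ (∀ w → u w ≡ true → w ∈ c)
⋁χv⇔ c = mk⇔
  (λ u⊨ w uw → Any.map (to (χv-≡-true⇔ _ w)) (to (⋁-cl⇔ χv c) u⊨ w uw))
  (λ u⊆c → from (⋁-cl⇔ χv c) λ w uw → Any.map (from (χv-≡-true⇔ _ w)) (u⊆c w uw))

UnionClosed⇒⋃ᵗ∈P : ∀ {P ts : List (Team k)} → UnionClosed P → ts ⊆ P → (∃ λ t → t ∈ ts) →
  ⋃ᵗ ts id ∈P P
UnionClosed⇒⋃ᵗ∈P {ts = ts} unionClosed ts⊆P inhabited =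
  unionClosed (_∈ ts) (λ _ → ∈⇒∈P ∘ ts⊆P) inhabited (⋃ᵗ ts id) (λ _ → ∈-⋃ᵗ⇔ ts id)

empty-property : ([] {A = Team k}) ≐‖ bot ∧ᶠ NE ‖
empty-property u = mk⇔ (λ ()) (λ (u-empty , v , uv) → contradiction (trans (sym uv) (u-empty v)) λ ())

formB⇔⊆⋃ : ∀ (P : List (Team k)) {u} → u ⊨ formB P ⇔ u ⊆ᵗ ⋃ᵗ P id
formB⇔⊆⋃ P = mk⇔
  (λ u⊨ w uw → from (∈-⋃ᵗ⇔ P id)
     (find (Any.map (λ {s} → trans (sym (evalC-χs s w))) (to (⋁-cl⇔ χs P) u⊨ w uw))))
  (λ u⊆ → from (⋁-cl⇔ χs P) λ w uw →
    let (s , s∈P , sw) = to (∈-⋃ᵗ⇔ P id) (u⊆ w uw) in lose s∈P (trans (evalC-χs s w) sw))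

∈P⇔⊆⋃ : ∀ {P : List (Team k)} → Convex P → UnionClosed P → emptyTeam ∈P P →
  ∀ {u} → u ∈P P ⇔ u ⊆ᵗ ⋃ᵗ P id
∈P⇔⊆⋃ {P = P} convex unionClosed ∅∈P {u} =
  mk⇔ below-⋃ (convex emptyTeam (⋃ᵗ P id) u ∅∈P ⋃∈P (λ _ ()))
  where
  ⋃∈P : ⋃ᵗ P id ∈P P
  ⋃∈P = UnionClosed⇒⋃ᵗ∈P unionClosed id (let (t , t∈P , _) = find ∅∈P in t , t∈P)
  below-⋃ : u ∈P P → u ⊆ᵗ ⋃ᵗ P id
  below-⋃ u∈P w uw =
    let (t , t∈P , u≗t) = find u∈P in from (∈-⋃ᵗ⇔ P id) (t , t∈P , trans (sym (u≗t w)) uw)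

∅∉P⇒⊨NE : ∀ {P : List (Team k)} → ¬ (emptyTeam ∈P P) → ∀ {t} → t ∈ P → t ⊨ NE
∅∉P⇒⊨NE ∅∉P {t} t∈P with ∃-Val? (λ v → t v Bool.≟ true)
... | yes inhabited = inhabited
... | no ¬inhabited = contradiction (lose t∈P λ v → sym (¬-not λ tv → ¬inhabited (v , tv))) ∅∉P

⊆ᵗ-or-escape : ∀ (t u : Team k) → t ⊆ᵗ u ⊎ ∃ λ v → t v ≡ true × u v ≡ false
⊆ᵗ-or-escape t u with ∃-Val? (λ v → (t v Bool.≟ true) ×-dec (u v Bool.≟ false))
... | yes escape  = inj₂ escape
... | no ¬escape = inj₁ λ v tv → ¬-not λ uv → ¬escape (v , tv , uv)

Meets : Team k → Team k → Set
Meets t u = ∃ λ v → t v ≡ true × u v ≡ true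

meets? : ∀ (u : Team k) → Decidable (λ t → Meets t u)
meets? u t = ∃-Val? (λ v → (t v Bool.≟ true) ×-dec (u v Bool.≟ true))

choiceFm : List (Val k) → Fm k
choiceFm c = ⋁ (map (cl ∘ χv) c) ∧ᶠ NE

module _ {P : List (Team k)} where

  member⇒formC : (∀ {t} → t ∈ P → t ⊨ NE) → ∀ {t} → t ∈ P → t ⊨ formC P
  member⇒formC nonempty {t} t∈P =
    ⊨-resp-≗ (formC P) ⋃slices≗t (⋁-intro choiceFm (choices P) slice slice⊨F)
    where
    slice : List (Val k) → Team k
    slice c w = t w && does (w ∈ᵛ? c)
    slice⊨F : ∀ {c} → c ∈ choices P → slice c ⊨ choiceFm c
    slice⊨F {c} c∈ =
      from (⋁χv⇔ c) (λ w e → to (does-≡-true⇔ (w ∈ᵛ? c)) (proj₂ (to &&-≡-true⇔ e))) ,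
      (let (v , v∈c , tv) = Pointwise-∈ʳ (to (∈-choices⇔ P) c∈) t∈P
       in v , from &&-≡-true⇔ (tv , from (does-≡-true⇔ (v ∈ᵛ? c)) v∈c))
    ⋃slices≗t : ⋃ᵗ (choices P) slice ≗ t
    ⋃slices≗t w = ≡-true⇔⇒≡ (mk⇔
      (λ e → let (_ , _ , slice-w) = to (∈-⋃ᵗ⇔ (choices P) slice) e in proj₁ (to &&-≡-true⇔ slice-w))
      (λ tw → let (c , choice , w∈c) = Pointwise-choose-through (All.tabulate nonempty) t∈P tw
              in from (∈-⋃ᵗ⇔ (choices P) slice)
                   (c , from (∈-choices⇔ P) choice ,
                    from &&-≡-true⇔ (tw , from (does-≡-true⇔ (w ∈ᵛ? c)) w∈c))))

  formC⇒member⊆ : ∀ {u} → u ⊨ formC P → Any (_⊆ᵗ u) P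
  formC⇒member⊆ {u} u⊨ with any-or-all (λ t → ⊆ᵗ-or-escape t u) P
  ... | inj₁ below   = below
  ... | inj₂ escapes =
    let (c , choice , c-outside-u) = Pointwise-choose escapes
        (s , (s⊨⋁ , w , sw) , s⊆u) = ⋁-part choiceFm u⊨ (from (∈-choices⇔ P) choice)
    in contradiction (trans (sym (s⊆u w sw)) (All.lookup c-outside-u (to (⋁χv⇔ c) s⊨⋁ w sw))) λ ()

  formC⇒⊆⋃meeting : ∀ {u} → u ⊨ formC P → u ⊆ᵗ ⋃ᵗ (filter (meets? u) P) id
  formC⇒⊆⋃meeting {u} u⊨ w uw =
    let (c , c∈ , s , (s⊨⋁ , _) , sw) = ⋁-cover choiceFm u⊨ uw
        (t , t∈P , tw) = Pointwise-∈ˡ (to (∈-choices⇔ P) c∈) (to (⋁χv⇔ c) s⊨⋁ w sw)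
    in from (∈-⋃ᵗ⇔ _ id) (t , ∈-filter⁺ (meets? u) t∈P (w , tw , uw) , tw)

  ∈P⇔formC : Convex P → UnionClosed P → ¬ (emptyTeam ∈P P) → ∀ {u} → u ∈P P ⇔ u ⊨ formC P
  ∈P⇔formC convex unionClosed ∅∉P {u} = mk⇔ member formula
    where
    member : u ∈P P → u ⊨ formC P
    member u∈P = let (t , t∈P , u≗t) = find u∈P
                 in ⊨-resp-≗ (formC P) (sym ∘ u≗t) (member⇒formC (∅∉P⇒⊨NE ∅∉P) t∈P)
    formula : u ⊨ formC P → u ∈P P
    formula u⊨ =
      let (t , t∈P , t⊆u) = find (formC⇒member⊆ u⊨)
          (v , tv) = ∅∉P⇒⊨NE ∅∉P t∈P
          ⋃∈P = UnionClosed⇒⋃ᵗ∈P unionClosed (proj₁ ∘ ∈-filter⁻ (meets? u))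
                  (t , ∈-filter⁺ (meets? u) t∈P (v , tv , t⊆u v tv))
      in convex t _ u (∈⇒∈P t∈P) ⋃∈P t⊆u (formC⇒⊆⋃meeting u⊨)

lemma3p4 : (k : ℕ) (P : List (Team k)) → Convex P → UnionClosed P →
    (P ≡ [] → P ≐‖ bot ∧ᶠ NE ‖)
    × (emptyTeam ∈P P → P ≐‖ formB P ‖)
    × (P ≢ [] → ¬ (emptyTeam ∈P P) → P ≐‖ formC P ‖)
-- Case (c) does not need P ≢ []: the only choice for [] is the empty tuple, whose disjunct
-- ⊥ ∧ NE has no models.
lemma3p4 k P convex unionClosed =
    (λ { refl → empty-property })
  , (λ ∅∈P u → ⇔-sym (formB⇔⊆⋃ P) ⇔-∘ ∈P⇔⊆⋃ convex unionClosed ∅∈P)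
  , (λ _ ∅∉P u → ∈P⇔formC convex unionClosed ∅∉P)
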